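{- Fix $d\geq 2$. Let $m=m(n)$ satisfy $1\ll n\ll m\ll n^{(d+1)/2}$ (that is, $n=o(m)$ and $m=o(n^{(d+1)/2})$). Then (for $n$ sufficiently large) there exists a pure $(d-1)$-dimensional simplicial complex with $n$ vertices and $\Theta(m)$ facets whose transversal number is $n-\Theta\left(n^{\frac{d}{d-1}}m^{ -\frac{1}{d-1}}\right)$. In particular, for all sufficiently large $n$, there exists a pure $(d-1)$-dimensional complex with $n$ vertices and $\Theta(n^{\lfloor d/2\rfloor})$ facets whose transversal number is $n-\Theta\big(n^{\lceil d/2\rceil/(d-1)}\big)$.
   Context: The transversal number of a pure simplicial complex is the minimum size of a set of vertices meeting every facet. Asymptotic notation is as $n\to\infty$ with $d$ fixed: $f=\Theta(g)$ means $cg\le f\le Cg$ for positive constants $c,C$ independent of $n$, and $f=n-\Theta(g)$ means $n-Cg\le f\le n-cg$ for such constants. -}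

module Defs where

open import Data.Nat using (ℕ; _+_; _*_; _∸_; _^_; _≤_)
open import Data.Product using (Σ; ∃; _×_; _,_)
open import Data.List using (List; length)
open import Data.List.Relation.Unary.All using (All)
open import Data.List.Relation.Unary.Any using (Any)
open import Data.List.Relation.Unary.Unique.Propositional using (Unique)
open import Data.Fin using (Fin)
open import Relation.Binary.PropositionalEquality using (_≡_)
open import Data.Fin.Subset using (Subset; _∈_; _∩_; ∣_∣; Nonempty)

-- A pure (k-1)-dimensional simplicial complex on the vertex set Fin n,
-- given by its facets: distinct k-element subsets of Fin n.
record PureComplex (n k : ℕ) : Set where
  field
    facets    : List (Subset n)
    facetSize : All (λ F → ∣ F ∣ ≡ k) facets
    distinct  : Unique facets
    covers    : ∀ (v : Fin n) → Any (λ F → v ∈ F) facets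
open PureComplex public

numFacets : ∀ {n k} → PureComplex n k → ℕ
numFacets K = length (facets K)

IsTransversal : ∀ {n k} → PureComplex n k → Subset n → Set
IsTransversal K T = All (λ F → Nonempty (F ∩ T)) (facets K)

TransversalNumber : ∀ {n k} → PureComplex n k → ℕ → Set
TransversalNumber {n} K t =
  (Σ (Subset n) λ T → IsTransversal K T × ∣ T ∣ ≡ t)
  × (∀ (T : Subset n) → IsTransversal K T → t ≤ ∣ T ∣)

Eventually : (ℕ → Set) → Set
Eventually P = ∃ λ N → ∀ n → N ≤ n → P n

-- A set of vertices misses some d-subset of a b-set exactly when its complement has at least
-- d elements, so the complete (d-1)-dimensional complex on b ≥ d vertices has transversal
-- number b - (d-1) and C(b,d) ≍ b^d facets. Both quantities add over disjoint unions, so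
-- cutting n vertices into blocks of sizes between s and 2s gives a complex with
-- N ≍ n·s^(d-1) facets and n - τ ≍ n/s. Taking s maximal with n·s^(d-1) ≲ m yields N ≍ m and
-- (n - τ)^(d-1) ≍ n^d/m, and m = n^⌊d/2⌋ gives the second statement.
module Submission where

open import Data.Bool using (_∧_)
open import Data.Empty using (⊥-elim)
open import Data.Fin using (Fin; zero; suc; _↑ˡ_; _↑ʳ_; join)
import Data.Fin as Fin
open import Data.Fin.Properties using (join-splitAt)
open import Data.Fin.Subset
  using (Subset; inside; outside; _∈_; _⊆_; _-_; _∩_; ∁; ⊥; ⊤; ∣_∣; Nonempty; Empty)
open import Data.Fin.Subset.Properties
  using ( drop-∷-⊆; in⊆in; s⊆s; out⊆; ⊥⊆; ⊆⊤; p⊆q⇒∣p∣≤∣q∣; ∣⊥∣≡0; ∣⊤∣≡n; ∣∁p∣≡n∸∣p∣; ∣p∣≤n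
        ; Empty-unique; x∈p⇒∣p-x∣<∣p∣; ∣⁅x⁆∣≡1; x∈⁅x⁆; ∉⊥; _∈?_; nonempty?
        ; x∉p⇒x∈∁p; x∈∁p⇒x∉p; x∈p∩q⁺; x∈p∩q⁻)
open import Data.List using (List; []; _∷_; map; length) renaming (_++_ to _++ₗ_)
open import Data.List.Properties using (length-++; length-map)
open import Data.List.Membership.Propositional using (lose) renaming (_∈_ to _∈ₗ_)
open import Data.List.Membership.Propositional.Properties using (∈-map⁺; ∈-map⁻; ∈-++⁺ˡ; ∈-++⁺ʳ)
open import Data.List.Relation.Binary.Disjoint.Propositional using (Disjoint)
open import Data.List.Relation.Unary.All as All using (All; []; _∷_)
import Data.List.Relation.Unary.All.Properties as All
open import Data.List.Relation.Unary.AllPairs using ([]; _∷_)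
open import Data.List.Relation.Unary.Any as Any using (Any; here)
import Data.List.Relation.Unary.Any.Properties as Any
open import Data.List.Relation.Unary.Unique.Propositional using (Unique)
import Data.List.Relation.Unary.Unique.Propositional.Properties as Unique
open import Data.Nat
  using (ℕ; zero; suc; _+_; _*_; _∸_; _^_; _≤_; _<_; z≤n; s≤s; NonZero; >-nonZero; >-nonZero⁻¹; ⌊_/2⌋)
open import Data.Nat.Combinatorics using (_C_; nCk+nC[k+1]≡[n+1]C[k+1]; nC1≡n)
open import Data.Nat.DivMod using (_/_; m/n≡1+[m∸n]/n)
open import Data.Nat.Induction using (<-rec)
open import Data.Nat.Properties
open import Algebra.Properties.CommutativeSemigroup *-commutativeSemigroup using (x∙yz≈y∙xz)
open import Data.Product using (Σ; ∃; _×_; _,_; proj₁)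
open import Data.Sum using (_⊎_; inj₁; inj₂; [_,_]′)
open import Data.Vec using (_∷_; []; _++_; splitAt; here; there)
open import Data.Vec.Properties using (zipWith-++; ∷-injectiveʳ; ++-injectiveˡ; ++-injectiveʳ)
open import Function using (id; _∘_)
open import Function.Bundles using (_⇔_; mk⇔; Equivalence)
open import Relation.Binary.PropositionalEquality
open import Relation.Nullary using (¬_; yes; no; contradiction)
open import Relation.Unary using (Decidable)

open import Defs

private variable
  m n : ℕ

-- Subsets of a finite set

∣p++q∣≡∣p∣+∣q∣ : ∀ (p : Subset m) (q : Subset n) → ∣ p ++ q ∣ ≡ ∣ p ∣ + ∣ q ∣
∣p++q∣≡∣p∣+∣q∣ []            q = refl
∣p++q∣≡∣p∣+∣q∣ (inside  ∷ p) q = cong suc (∣p++q∣≡∣p∣+∣q∣ p q)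
∣p++q∣≡∣p∣+∣q∣ (outside ∷ p) q = ∣p++q∣≡∣p∣+∣q∣ p q

x∈p⇒x↑ˡ∈p++q : ∀ {x : Fin m} {p : Subset m} (q : Subset n) → x ∈ p → x ↑ˡ n ∈ p ++ q
x∈p⇒x↑ˡ∈p++q q here        = here
x∈p⇒x↑ˡ∈p++q q (there x∈p) = there (x∈p⇒x↑ˡ∈p++q q x∈p)

x∈q⇒m↑ʳx∈p++q : ∀ {x : Fin n} (p : Subset m) {q : Subset n} → x ∈ q → m ↑ʳ x ∈ p ++ q
x∈q⇒m↑ʳx∈p++q []      x∈q = x∈q
x∈q⇒m↑ʳx∈p++q (_ ∷ p) x∈q = there (x∈q⇒m↑ʳx∈p++q p x∈q)

Nonempty-++⁺ : ∀ (p : Subset m) (q : Subset n) → Nonempty p ⊎ Nonempty q → Nonempty (p ++ q)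
Nonempty-++⁺ {n = n} p q (inj₁ (x , x∈p)) = x ↑ˡ n , x∈p⇒x↑ˡ∈p++q q x∈p
Nonempty-++⁺ {m = m} p q (inj₂ (x , x∈q)) = m ↑ʳ x , x∈q⇒m↑ʳx∈p++q p x∈q

Nonempty-++⁻ : ∀ (p : Subset m) {q : Subset n} → Nonempty (p ++ q) → Nonempty p ⊎ Nonempty q
Nonempty-++⁻ []      ne                 = inj₂ ne
Nonempty-++⁻ (_ ∷ p) (zero  , here)     = inj₁ (zero , here)
Nonempty-++⁻ (_ ∷ p) (suc x , there x∈) with Nonempty-++⁻ p (x , x∈)
... | inj₁ (y , y∈p) = inj₁ (suc y , there y∈p)
... | inj₂ ne        = inj₂ ne

Nonempty-∩-++ : ∀ (p p′ : Subset m) (q q′ : Subset n) →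
                Nonempty ((p ++ q) ∩ (p′ ++ q′)) ⇔ (Nonempty (p ∩ p′) ⊎ Nonempty (q ∩ q′))
Nonempty-∩-++ p p′ q q′ = mk⇔
  (Nonempty-++⁻ (p ∩ p′) ∘ subst Nonempty ∩-++)
  (subst Nonempty (sym ∩-++) ∘ Nonempty-++⁺ (p ∩ p′) (q ∩ q′))
  where
  ∩-++ : (p ++ q) ∩ (p′ ++ q′) ≡ (p ∩ p′) ++ (q ∩ q′)
  ∩-++ = zipWith-++ _∧_ p q p′ q′

⊥∩p-empty : ∀ (p : Subset n) → Empty (⊥ ∩ p)
⊥∩p-empty p (x , x∈⊥∩p) = ∉⊥ (proj₁ (x∈p∩q⁻ ⊥ p x∈⊥∩p))

subset-of-size : ∀ {p q : Subset n} k → p ⊆ q → ∣ p ∣ ≤ k → k ≤ ∣ q ∣ →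
                 ∃ λ r → p ⊆ r × r ⊆ q × ∣ r ∣ ≡ k
subset-of-size {p = []} {[]} zero _ _ _ = [] , id , id , refl
subset-of-size {p = inside ∷ p} {outside ∷ q} k p⊆q _ _ with () ← p⊆q here
subset-of-size {p = inside ∷ p} {inside ∷ q} (suc k) p⊆q (s≤s ∣p∣≤k) (s≤s k≤∣q∣)
  with r , p⊆r , r⊆q , ∣r∣≡k ← subset-of-size k (drop-∷-⊆ p⊆q) ∣p∣≤k k≤∣q∣
  = inside ∷ r , in⊆in p⊆r , in⊆in r⊆q , cong suc ∣r∣≡k
subset-of-size {p = outside ∷ p} {outside ∷ q} k p⊆q ∣p∣≤k k≤∣q∣
  with r , p⊆r , r⊆q , ∣r∣≡k ← subset-of-size k (drop-∷-⊆ p⊆q) ∣p∣≤k k≤∣q∣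
  = outside ∷ r , s⊆s p⊆r , s⊆s r⊆q , ∣r∣≡k
subset-of-size {p = outside ∷ p} {inside ∷ q} k p⊆q ∣p∣≤k k≤1+∣q∣ with k ≤? ∣ q ∣
... | yes k≤∣q∣ with r , p⊆r , r⊆q , ∣r∣≡k ← subset-of-size k (drop-∷-⊆ p⊆q) ∣p∣≤k k≤∣q∣
  = outside ∷ r , s⊆s p⊆r , out⊆ r⊆q , ∣r∣≡k
... | no k≰∣q∣ = inside ∷ q , p⊆q , id , ≤-antisym (≰⇒> k≰∣q∣) k≤1+∣q∣

∃⊆-of-size : ∀ {k} {q : Subset n} → k ≤ ∣ q ∣ → ∃ λ r → r ⊆ q × ∣ r ∣ ≡ k
∃⊆-of-size {n} {k} k≤∣q∣
  with r , _ , r⊆q , ∣r∣≡k ← subset-of-size k ⊥⊆ (subst (_≤ k) (sym (∣⊥∣≡0 n)) z≤n) k≤∣q∣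
  = r , r⊆q , ∣r∣≡k

∣p∣+∣q∣>n⇒p∩q≢∅ : ∀ (p q : Subset n) → n < ∣ p ∣ + ∣ q ∣ → Nonempty (p ∩ q)
∣p∣+∣q∣>n⇒p∩q≢∅ {n} p q n<∣p∣+∣q∣ with nonempty? (p ∩ q)
... | yes p∩q≢∅ = p∩q≢∅
... | no  p∩q≡∅ = contradiction (m≤o∸n⇒m+n≤o ∣ p ∣ (∣p∣≤n q) ∣p∣≤n∸∣q∣) (<⇒≱ n<∣p∣+∣q∣)
  where
  p⊆∁q : p ⊆ ∁ q
  p⊆∁q {x} x∈p with x ∈? q
  ... | yes x∈q = contradiction (x , x∈p∩q⁺ (x∈p , x∈q)) p∩q≡∅
  ... | no  x∉q = x∉p⇒x∈∁p x∉q
  ∣p∣≤n∸∣q∣ : ∣ p ∣ ≤ n ∸ ∣ q ∣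
  ∣p∣≤n∸∣q∣ = subst (∣ p ∣ ≤_) (∣∁p∣≡n∸∣p∣ q) (p⊆q⇒∣p∣≤∣q∣ p⊆∁q)

meets-all-of-size⇒∣∁T∣<k : ∀ {k} (T : Subset n) → (∀ {F} → ∣ F ∣ ≡ k → Nonempty (F ∩ T)) → ∣ ∁ T ∣ < k
meets-all-of-size⇒∣∁T∣<k {n} {k} T meets with k ≤? ∣ ∁ T ∣
... | no  k≰∣∁T∣ = ≰⇒> k≰∣∁T∣
... | yes k≤∣∁T∣
  with F , F⊆∁T , ∣F∣≡k ← ∃⊆-of-size k≤∣∁T∣
  with x , x∈F∩T ← meets ∣F∣≡k
  with x∈F , x∈T ← x∈p∩q⁻ F T x∈F∩T
  = contradiction x∈T (x∈∁p⇒x∉p (F⊆∁T x∈F))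

-- Binomial coefficients

^-distribʳ-* : ∀ m n k → (m * n) ^ k ≡ m ^ k * n ^ k
^-distribʳ-* m n zero    = refl
^-distribʳ-* m n (suc k) = begin
  m * n * (m * n) ^ k       ≡⟨ cong (m * n *_) (^-distribʳ-* m n k) ⟩
  m * n * (m ^ k * n ^ k)   ≡⟨ [m*n]*[o*p]≡[m*o]*[n*p] m n (m ^ k) (n ^ k) ⟩
  m * m ^ k * (n * n ^ k)   ∎
  where open ≡-Reasoning

nCk≤n^k : ∀ n k → n C k ≤ n ^ k
nCk≤n^k n       zero    = ≤-refl
nCk≤n^k zero    (suc k) = z≤n
nCk≤n^k (suc n) (suc k) = begin
  suc n C suc k              ≡⟨ nCk+nC[k+1]≡[n+1]C[k+1] n k ⟨
  n C k + n C suc k          ≤⟨ +-mono-≤ (nCk≤n^k n k) (nCk≤n^k n (suc k)) ⟩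
  n ^ k + n * n ^ k          ≤⟨ +-mono-≤ (^-monoˡ-≤ k (n≤1+n n)) (*-monoʳ-≤ n (^-monoˡ-≤ k (n≤1+n n))) ⟩
  suc n ^ k + n * suc n ^ k  ∎
  where open ≤-Reasoning

[1+k]*[1+n]C[1+k]≡[1+n]*nCk : ∀ n k → suc k * (suc n C suc k) ≡ suc n * (n C k)
[1+k]*[1+n]C[1+k]≡[1+n]*nCk zero    zero    = refl
[1+k]*[1+n]C[1+k]≡[1+n]*nCk zero    (suc k) = *-zeroʳ (2 + k)
[1+k]*[1+n]C[1+k]≡[1+n]*nCk (suc n) zero    =
  trans (*-identityˡ _) (trans (nC1≡n (2 + n)) (sym (*-identityʳ (2 + n))))
[1+k]*[1+n]C[1+k]≡[1+n]*nCk (suc n) (suc k) = begin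
  (2 + k) * ((2 + n) C (2 + k))                  ≡⟨ cong ((2 + k) *_) (nCk+nC[k+1]≡[n+1]C[k+1] (suc n) (suc k)) ⟨
  (2 + k) * (X + suc n C (2 + k))                ≡⟨ *-distribˡ-+ (2 + k) X _ ⟩
  (X + suc k * X) + (2 + k) * (suc n C (2 + k))  ≡⟨ cong₂ (λ a b → (X + a) + b) ([1+k]*[1+n]C[1+k]≡[1+n]*nCk n k)
                                                                               ([1+k]*[1+n]C[1+k]≡[1+n]*nCk n (suc k)) ⟩
  (X + suc n * (n C k)) + suc n * (n C suc k)    ≡⟨ +-assoc X _ _ ⟩
  X + (suc n * (n C k) + suc n * (n C suc k))    ≡⟨ cong (X +_) (*-distribˡ-+ (suc n) (n C k) _) ⟨
  X + suc n * (n C k + n C suc k)                ≡⟨ cong (λ a → X + suc n * a) (nCk+nC[k+1]≡[n+1]C[k+1] n k) ⟩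
  X + suc n * X                                  ∎
  where
  open ≡-Reasoning
  X = suc n C suc k

n^k≤k^k*nCk : ∀ {n k} → k ≤ n → n ^ k ≤ k ^ k * (n C k)
n^k≤k^k*nCk {n}     {zero}  _         = ≤-refl
n^k≤k^k*nCk {suc n} {suc k} (s≤s k≤n) = begin
  suc n * suc n ^ k                     ≤⟨ *-monoʳ-≤ (suc n) (raise k≤n (n^k≤k^k*nCk k≤n)) ⟩
  suc n * (suc k ^ k * (n C k))         ≡⟨ x∙yz≈y∙xz (suc n) (suc k ^ k) (n C k) ⟩
  suc k ^ k * (suc n * (n C k))         ≡⟨ cong (suc k ^ k *_) ([1+k]*[1+n]C[1+k]≡[1+n]*nCk n k) ⟨
  suc k ^ k * (suc k * (suc n C suc k)) ≡⟨ x∙yz≈y∙xz (suc k ^ k) (suc k) _ ⟩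
  suc k * (suc k ^ k * (suc n C suc k)) ≡⟨ *-assoc (suc k) (suc k ^ k) _ ⟨
  suc k ^ suc k * (suc n C suc k)       ∎
  where
  open ≤-Reasoning
  raise : ∀ {n k} → k ≤ n → n ^ k ≤ k ^ k * (n C k) → suc n ^ k ≤ suc k ^ k * (n C k)
  raise {k = zero}      _   _  = ≤-refl
  raise {n} {k@(suc _)} k≤n ih = *-cancelˡ-≤ (k ^ k) {{m^n≢0 k k}} (begin
    k ^ k * suc n ^ k             ≡⟨ ^-distribʳ-* k (suc n) k ⟨
    (k * suc n) ^ k               ≤⟨ ^-monoˡ-≤ k (≤-trans (≤-reflexive (*-suc k n)) (+-monoˡ-≤ (k * n) k≤n)) ⟩
    (suc k * n) ^ k               ≡⟨ ^-distribʳ-* (suc k) n k ⟩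
    suc k ^ k * n ^ k             ≤⟨ *-monoʳ-≤ (suc k ^ k) ih ⟩
    suc k ^ k * (k ^ k * (n C k)) ≡⟨ x∙yz≈y∙xz (suc k ^ k) (k ^ k) (n C k) ⟩
    k ^ k * (suc k ^ k * (n C k)) ∎)

-- Complete complexes and disjoint unions

choose : ∀ (k n : ℕ) → List (Subset n)
choose zero    n       = ⊥ ∷ []
choose (suc k) zero    = []
choose (suc k) (suc n) = map (inside ∷_) (choose k n) ++ₗ map (outside ∷_) (choose (suc k) n)

choose-size : ∀ (k n : ℕ) → All (λ F → ∣ F ∣ ≡ k) (choose k n)
choose-size zero    n       = ∣⊥∣≡0 n ∷ []
choose-size (suc k) zero    = []
choose-size (suc k) (suc n) =
  All.++⁺ (All.map⁺ (All.map (cong suc) (choose-size k n))) (All.map⁺ (choose-size (suc k) n))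

choose-unique : ∀ (k n : ℕ) → Unique (choose k n)
choose-unique zero    n       = [] ∷ []
choose-unique (suc k) zero    = []
choose-unique (suc k) (suc n) = Unique.++⁺
  (Unique.map⁺ ∷-injectiveʳ (choose-unique k n))
  (Unique.map⁺ ∷-injectiveʳ (choose-unique (suc k) n))
  disjoint
  where
  disjoint : Disjoint (map (inside ∷_) (choose k n)) (map (outside ∷_) (choose (suc k) n))
  disjoint (F∈ , G∈) with ∈-map⁻ (inside ∷_) F∈ | ∈-map⁻ (outside ∷_) G∈
  ... | _ , _ , refl | _ , _ , ()

∈-choose : ∀ {k n} (p : Subset n) → ∣ p ∣ ≡ k → p ∈ₗ choose k n
∈-choose {zero}  p             ∣p∣≡0 =
  here (Empty-unique λ (x , x∈p) → n≮0 (subst (∣ p - x ∣ <_) ∣p∣≡0 (x∈p⇒∣p-x∣<∣p∣ x∈p)))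
∈-choose {suc k} (inside  ∷ p) ∣p∣≡k = ∈-++⁺ˡ (∈-map⁺ (inside ∷_) (∈-choose p (suc-injective ∣p∣≡k)))
∈-choose {suc k} (outside ∷ p) ∣p∣≡k = ∈-++⁺ʳ _ (∈-map⁺ (outside ∷_) (∈-choose p ∣p∣≡k))

length-choose : ∀ (k n : ℕ) → length (choose k n) ≡ n C k
length-choose zero    n       = refl
length-choose (suc k) zero    = refl
length-choose (suc k) (suc n) = begin
  length (map (inside ∷_) (choose k n) ++ₗ map (outside ∷_) (choose (suc k) n))
    ≡⟨ length-++ (map (inside ∷_) (choose k n)) ⟩
  length (map (inside ∷_) (choose k n)) + length (map (outside ∷_) (choose (suc k) n))
    ≡⟨ cong₂ _+_ (length-map _ (choose k n)) (length-map _ (choose (suc k) n)) ⟩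
  length (choose k n) + length (choose (suc k) n)
    ≡⟨ cong₂ _+_ (length-choose k n) (length-choose (suc k) n) ⟩
  n C k + n C suc k
    ≡⟨ nCk+nC[k+1]≡[n+1]C[k+1] n k ⟩
  suc n C suc k
    ∎
  where open ≡-Reasoning

complete : ∀ e n → e < n → PureComplex n (suc e)
complete e n e<n = record
  { facets    = choose (suc e) n
  ; facetSize = choose-size (suc e) n
  ; distinct  = choose-unique (suc e) n
  ; covers    = in-some-facet
  }
  where
  in-some-facet : ∀ i → Any (i ∈_) (choose (suc e) n)
  in-some-facet i
    with r , ⁅i⁆⊆r , _ , ∣r∣≡1+e ← subset-of-size (suc e) ⊆⊤
           (subst (_≤ suc e) (sym (∣⁅x⁆∣≡1 i)) (s≤s z≤n)) (subst (suc e ≤_) (sym (∣⊤∣≡n n)) e<n)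
    = lose (∈-choose r ∣r∣≡1+e) (⁅i⁆⊆r (x∈⁅x⁆ i))

complete-transversalNumber : ∀ e n (e<n : e < n) → TransversalNumber (complete e n e<n) (n ∸ e)
complete-transversalNumber e n e<n
  with T , _ , ∣T∣≡n∸e ← ∃⊆-of-size {q = ⊤} (subst (n ∸ e ≤_) (sym (∣⊤∣≡n n)) (m∸n≤m n e))
  = (T , All.map meets (choose-size (suc e) n) , ∣T∣≡n∸e) , minimal
  where
  meets : ∀ {F} → ∣ F ∣ ≡ suc e → Nonempty (F ∩ T)
  meets {F} ∣F∣≡1+e = ∣p∣+∣q∣>n⇒p∩q≢∅ F T
    (≤-reflexive (trans (cong suc (sym (m+[n∸m]≡n (<⇒≤ e<n)))) (cong₂ _+_ (sym ∣F∣≡1+e) (sym ∣T∣≡n∸e))))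
  minimal : ∀ T′ → IsTransversal (complete e n e<n) T′ → n ∸ e ≤ ∣ T′ ∣
  minimal T′ isT = m≤n+o⇒m∸n≤o n e (begin
    n                      ≤⟨ m≤n+m∸n n ∣ T′ ∣ ⟩
    ∣ T′ ∣ + (n ∸ ∣ T′ ∣)  ≤⟨ +-monoʳ-≤ ∣ T′ ∣ (≤-pred n∸∣T′∣<1+e) ⟩
    ∣ T′ ∣ + e             ≡⟨ +-comm ∣ T′ ∣ e ⟩
    e + ∣ T′ ∣             ∎)
    where
    open ≤-Reasoning
    n∸∣T′∣<1+e : n ∸ ∣ T′ ∣ < suc e
    n∸∣T′∣<1+e = subst (_< suc e) (∣∁p∣≡n∸∣p∣ T′)
      (meets-all-of-size⇒∣∁T∣<k T′ λ {F} ∣F∣≡1+e → All.lookup isT (∈-choose F ∣F∣≡1+e))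

infixr 5 _⊕_

_⊕_ : ∀ {a b e} → PureComplex a (suc e) → PureComplex b (suc e) → PureComplex (a + b) (suc e)
_⊕_ {a} {b} {e} K L = record
  { facets    = Fs
  ; facetSize = All.++⁺ (All.map⁺ (All.map (λ {F} → padʳ {F}) (facetSize K)))
                        (All.map⁺ (All.map (λ {G} → padˡ {G}) (facetSize L)))
  ; distinct  = Unique.++⁺ (Unique.map⁺ (++-injectiveˡ _ _) (distinct K))
                           (Unique.map⁺ (++-injectiveʳ ⊥ ⊥) (distinct L)) disjoint
  ; covers    = λ v → subst (λ v → Any (v ∈_) Fs) (join-splitAt a b v) (in-some-facet (Fin.splitAt a v))
  }
  where
  Fs : List (Subset (a + b))
  Fs = map (_++ ⊥) (facets K) ++ₗ map (⊥ ++_) (facets L)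
  padʳ : ∀ {F : Subset a} → ∣ F ∣ ≡ suc e → ∣ F ++ ⊥ {b} ∣ ≡ suc e
  padʳ {F} ∣F∣≡1+e = trans (∣p++q∣≡∣p∣+∣q∣ F (⊥ {b})) (trans (cong₂ _+_ ∣F∣≡1+e (∣⊥∣≡0 b)) (+-identityʳ _))
  padˡ : ∀ {G : Subset b} → ∣ G ∣ ≡ suc e → ∣ ⊥ {a} ++ G ∣ ≡ suc e
  padˡ {G} ∣G∣≡1+e = trans (∣p++q∣≡∣p∣+∣q∣ (⊥ {a}) G) (trans (cong (_+ ∣ G ∣) (∣⊥∣≡0 a)) ∣G∣≡1+e)
  disjoint : Disjoint (map (_++ ⊥) (facets K)) (map (⊥ ++_) (facets L))
  disjoint (F∈ , G∈) with ∈-map⁻ (_++ ⊥) F∈ | ∈-map⁻ (⊥ ++_) G∈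
  ... | F , F∈K , refl | G , _ , F++⊥≡⊥++G = 0≢1+n (begin
    0          ≡⟨ ∣⊥∣≡0 a ⟨
    ∣ ⊥ {a} ∣  ≡⟨ cong ∣_∣ (++-injectiveˡ F ⊥ F++⊥≡⊥++G) ⟨
    ∣ F ∣      ≡⟨ All.lookup (facetSize K) F∈K ⟩
    suc e      ∎)
    where open ≡-Reasoning
  in-some-facet : ∀ i → Any (join a b i ∈_) Fs
  in-some-facet (inj₁ i) = Any.++⁺ˡ (Any.map⁺ (Any.map (x∈p⇒x↑ˡ∈p++q ⊥) (covers K i)))
  in-some-facet (inj₂ j) = Any.++⁺ʳ _ (Any.map⁺ (Any.map (x∈q⇒m↑ʳx∈p++q ⊥) (covers L j)))

module _ {a b e} {K : PureComplex a (suc e)} {L : PureComplex b (suc e)} where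

  ⊕-transversal⁺ : ∀ {T U} → IsTransversal K T → IsTransversal L U → IsTransversal (K ⊕ L) (T ++ U)
  ⊕-transversal⁺ {T} {U} isT isU =
    All.++⁺ (All.map⁺ (All.map (λ {F} ne → Equivalence.from (Nonempty-∩-++ F T ⊥ U) (inj₁ ne)) isT))
            (All.map⁺ (All.map (λ {G} ne → Equivalence.from (Nonempty-∩-++ ⊥ T G U) (inj₂ ne)) isU))

  ⊕-transversal⁻ : ∀ {T U} → IsTransversal (K ⊕ L) (T ++ U) → IsTransversal K T × IsTransversal L U
  ⊕-transversal⁻ {T} {U} isTU with isT , isU ← All.++⁻ _ isTU =
    All.map (λ {F} ne → [ id , ⊥-elim ∘ ⊥∩p-empty U ]′ (Equivalence.to (Nonempty-∩-++ F T ⊥ U) ne)) (All.map⁻ isT) ,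
    All.map (λ {G} ne → [ ⊥-elim ∘ ⊥∩p-empty T , id ]′ (Equivalence.to (Nonempty-∩-++ ⊥ T G U) ne)) (All.map⁻ isU)

  ⊕-transversalNumber : ∀ {t u} → TransversalNumber K t → TransversalNumber L u →
                        TransversalNumber (K ⊕ L) (t + u)
  ⊕-transversalNumber {t} {u} ((T , isT , ∣T∣≡t) , minK) ((U , isU , ∣U∣≡u) , minL) =
    (T ++ U , ⊕-transversal⁺ isT isU , trans (∣p++q∣≡∣p∣+∣q∣ T U) (cong₂ _+_ ∣T∣≡t ∣U∣≡u)) , minimal
    where
    minimal : ∀ V → IsTransversal (K ⊕ L) V → t + u ≤ ∣ V ∣
    minimal V isV with T′ , U′ , refl ← splitAt a V with isT′ , isU′ ← ⊕-transversal⁻ isV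
      = subst (t + u ≤_) (sym (∣p++q∣≡∣p∣+∣q∣ T′ U′)) (+-mono-≤ (minK T′ isT′) (minL U′ isU′))

  numFacets-⊕ : numFacets (K ⊕ L) ≡ numFacets K + numFacets L
  numFacets-⊕ = trans (length-++ (map (_++ ⊥) (facets K)))
                      (cong₂ _+_ (length-map _ (facets K)) (length-map _ (facets L)))

transversalNumber≤n : ∀ {n d} {K : PureComplex n d} {t} → TransversalNumber K t → t ≤ n
transversalNumber≤n ((T , _ , ∣T∣≡t) , _) = subst (_≤ _) ∣T∣≡t (∣p∣≤n T)

-- Comparability up to a constant factor

infix 4 _≍⟨_⟩_

record _≍⟨_⟩_ (x c y : ℕ) : Set where
  constructor _,_
  field
    upper : x ≤ c * y
    lower : y ≤ c * x

private variable
  c c′ x x′ y y′ z : ℕ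

≍-sym : x ≍⟨ c ⟩ y → y ≍⟨ c ⟩ x
≍-sym (x≤ , y≤) = y≤ , x≤

≍-weaken : c ≤ c′ → x ≍⟨ c ⟩ y → x ≍⟨ c′ ⟩ y
≍-weaken {x = x} {y = y} c≤c′ (x≤ , y≤) = ≤-trans x≤ (*-monoˡ-≤ y c≤c′) , ≤-trans y≤ (*-monoˡ-≤ x c≤c′)

≍-trans : x ≍⟨ c ⟩ y → y ≍⟨ c′ ⟩ z → x ≍⟨ c * c′ ⟩ z
≍-trans {x} {c} {y} {c′} {z} (x≤ , y≤) (y≤′ , z≤) =
  ≤-trans x≤ (≤-trans (*-monoʳ-≤ c y≤′) (≤-reflexive (sym (*-assoc c c′ z)))) ,
  ≤-trans z≤ (≤-trans (*-monoʳ-≤ c′ y≤) (≤-reflexive (trans (sym (*-assoc c′ c x)) (cong (_* x) (*-comm c′ c)))))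

≍-+ : x ≍⟨ c ⟩ y → x′ ≍⟨ c ⟩ y′ → x + x′ ≍⟨ c ⟩ y + y′
≍-+ {x} {c} {y} {x′} {y′} (x≤ , y≤) (x′≤ , y′≤) =
  ≤-trans (+-mono-≤ x≤ x′≤) (≤-reflexive (sym (*-distribˡ-+ c y y′))) ,
  ≤-trans (+-mono-≤ y≤ y′≤) (≤-reflexive (sym (*-distribˡ-+ c x x′)))

≍-* : x ≍⟨ c ⟩ y → x′ ≍⟨ c′ ⟩ y′ → x * x′ ≍⟨ c * c′ ⟩ y * y′
≍-* {x} {c} {y} {x′} {c′} {y′} (x≤ , y≤) (x′≤ , y′≤) =
  ≤-trans (*-mono-≤ x≤ x′≤) (≤-reflexive ([m*n]*[o*p]≡[m*o]*[n*p] c y c′ y′)) ,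
  ≤-trans (*-mono-≤ y≤ y′≤) (≤-reflexive ([m*n]*[o*p]≡[m*o]*[n*p] c x c′ x′))

≍-*ˡ : ∀ z → x ≍⟨ c ⟩ y → z * x ≍⟨ c ⟩ z * y
≍-*ˡ {x} {c} {y} z (x≤ , y≤) = ≤-trans (*-monoʳ-≤ z x≤) (≤-reflexive (x∙yz≈y∙xz z c y))
                             , ≤-trans (*-monoʳ-≤ z y≤) (≤-reflexive (x∙yz≈y∙xz z c x))

≍-*ʳ : ∀ z → x ≍⟨ c ⟩ y → x * z ≍⟨ c ⟩ y * z
≍-*ʳ {x} {c} {y} z (x≤ , y≤) = ≤-trans (*-monoˡ-≤ z x≤) (≤-reflexive (*-assoc c y z))
                             , ≤-trans (*-monoˡ-≤ z y≤) (≤-reflexive (*-assoc c x z))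

≍-^ : ∀ k → x ≍⟨ c ⟩ y → x ^ k ≍⟨ c ^ k ⟩ y ^ k
≍-^ zero    _   = ≤-refl , ≤-refl
≍-^ (suc k) x≍y = ≍-* x≍y (≍-^ k x≍y)

-- Block complexes

ComplexWith : ℕ → ℕ → (ℕ → ℕ → Set) → Set
ComplexWith d n P = Σ (PureComplex n d) λ K → ∃ λ t → TransversalNumber K t × P (numFacets K) (n ∸ t)

ComplexWith-map : ∀ {d n} {P Q : ℕ → ℕ → Set} → (∀ N α → P N α → Q N α) → ComplexWith d n P → ComplexWith d n Q
ComplexWith-map f (K , t , τ , p) = K , t , τ , f _ _ p

-- The second condition is α ≍ n/s, written without division.
Balanced : (c s e n N α : ℕ) → Set
Balanced c s e n N α = (N ≍⟨ c ⟩ n * s ^ e) × (n ≍⟨ c ⟩ s * α)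

Balanced-+ : ∀ {c s e a b N N′ α β} → Balanced c s e a N α → Balanced c s e b N′ β →
             Balanced c s e (a + b) (N + N′) (α + β)
Balanced-+ {c} {s} {e} {a} {b} {N} {N′} {α} {β} (N≍ , a≍) (N′≍ , b≍) =
  subst (N + N′ ≍⟨ c ⟩_) (sym (*-distribʳ-+ (s ^ e) a b)) (≍-+ N≍ N′≍) ,
  subst (a + b ≍⟨ c ⟩_) (sym (*-distribˡ-+ s α β)) (≍-+ a≍ b≍)

[m+n]∸[o+p]≡[m∸o]+[n∸p] : ∀ {m n o p} → o ≤ m → p ≤ n → (m + n) ∸ (o + p) ≡ (m ∸ o) + (n ∸ p)
[m+n]∸[o+p]≡[m∸o]+[n∸p] {m} {n} {o} {p} o≤m p≤n = begin
  (m + n) ∸ (o + p)   ≡⟨ ∸-+-assoc (m + n) o p ⟨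
  (m + n) ∸ o ∸ p     ≡⟨ cong (_∸ p) (+-∸-comm n o≤m) ⟩
  (m ∸ o) + n ∸ p     ≡⟨ +-∸-assoc (m ∸ o) p≤n ⟩
  (m ∸ o) + (n ∸ p)   ∎
  where open ≡-Reasoning

⊕-balanced : ∀ {c s e a b} → ComplexWith (suc e) a (Balanced c s e a) → ComplexWith (suc e) b (Balanced c s e b) →
             ComplexWith (suc e) (a + b) (Balanced c s e (a + b))
⊕-balanced {c} {s} {e} {a} {b} (K , t , τK , balK) (L , u , τL , balL) =
  K ⊕ L , t + u , ⊕-transversalNumber {K = K} {L = L} τK τL ,
  subst₂ (Balanced c s e (a + b)) (sym (numFacets-⊕ {K = K} {L = L}))
         (sym ([m+n]∸[o+p]≡[m∸o]+[n∸p] (transversalNumber≤n {K = K} τK) (transversalNumber≤n {K = L} τL)))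
         (Balanced-+ {c} {s} {e} balK balL)

-- The second condition is α^e ≍ n^(e+1)/m, written without division.
Profile : (A e n m N α : ℕ) → Set
Profile A e n m N α = (N ≍⟨ A ⟩ m) × (n ^ suc e ≍⟨ A ^ e ⟩ m * α ^ e)

maximal-in-range : ∀ {P : ℕ → Set} → Decidable P → ∀ {a b} → P a → a ≤ b →
                   ∃ λ s → a ≤ s × s ≤ b × P s × (s ≡ b ⊎ ¬ P (suc s))
maximal-in-range P? {b = zero}  pa z≤n   = zero , z≤n , z≤n , pa , inj₁ refl
maximal-in-range P? {b = suc b} pa a≤1+b with m≤n⇒m<n∨m≡n a≤1+b
... | inj₂ refl = suc b , ≤-refl , ≤-refl , pa , inj₁ refl
... | inj₁ (s≤s a≤b) with maximal-in-range P? pa a≤b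
...   | s , a≤s , s≤b , ps , inj₂ ¬ps+1 = s , a≤s , m≤n⇒m≤1+n s≤b , ps , inj₂ ¬ps+1
...   | s , a≤s , _   , ps , inj₁ refl with P? (suc s)
...     | yes ps+1 = suc s , m≤n⇒m≤1+n a≤s , ≤-refl , ps+1 , inj₁ refl
...     | no ¬ps+1 = s , a≤s , n≤1+n s , ps , inj₂ ¬ps+1

module BlockConstruction (e : ℕ) .{{_ : NonZero e}} where

  d : ℕ
  d = suc e

  κ : ℕ
  κ = (2 * d) ^ d

  instance
    κ≢0 : NonZero κ
    κ≢0 = m^n≢0 (2 * d) d

  x≤κ : ∀ {x} → x ≤ 2 * d → x ≤ κ
  x≤κ x≤2d = ≤-trans x≤2d (m≤m*n (2 * d) ((2 * d) ^ e) {{m^n≢0 (2 * d) e}})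

  x^k≤κ : ∀ {x k} → x ≤ 2 * d → k ≤ d → x ^ k ≤ κ
  x^k≤κ {x} {k} x≤2d k≤d = ≤-trans (^-monoˡ-≤ k x≤2d) (^-monoʳ-≤ (2 * d) k≤d)

  2≤2d : 2 ≤ 2 * d
  2≤2d = *-monoʳ-≤ 2 (s≤s z≤n)

  complete-balanced : ∀ {s b} → d ≤ s → s ≤ b → b ≤ 2 * s → ComplexWith d b (Balanced κ s e b)
  complete-balanced {s} {b} d≤s s≤b b≤2s =
    complete e b e<b , b ∸ e , complete-transversalNumber e b e<b ,
    subst₂ (Balanced κ s e b) (sym (length-choose d b)) (sym (m∸[m∸n]≡n (<⇒≤ e<b))) (N≍ , b≍)
    where
    open ≤-Reasoning
    e<b : e < b
    e<b = ≤-trans d≤s s≤b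
    N≍ : b C d ≍⟨ κ ⟩ b * s ^ e
    N≍ = (begin
      b C d                ≤⟨ nCk≤n^k b d ⟩
      b * b ^ e            ≤⟨ *-monoʳ-≤ b (^-monoˡ-≤ e b≤2s) ⟩
      b * (2 * s) ^ e      ≡⟨ cong (b *_) (^-distribʳ-* 2 s e) ⟩
      b * (2 ^ e * s ^ e)  ≡⟨ x∙yz≈y∙xz b (2 ^ e) (s ^ e) ⟩
      2 ^ e * (b * s ^ e)  ≤⟨ *-monoˡ-≤ (b * s ^ e) (x^k≤κ 2≤2d (n≤1+n e)) ⟩
      κ * (b * s ^ e)      ∎) , (begin
      b * s ^ e            ≤⟨ *-monoʳ-≤ b (^-monoˡ-≤ e s≤b) ⟩
      b * b ^ e            ≤⟨ n^k≤k^k*nCk (≤-trans d≤s s≤b) ⟩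
      d ^ d * (b C d)      ≤⟨ *-monoˡ-≤ (b C d) (x^k≤κ (m≤m+n d _) ≤-refl) ⟩
      κ * (b C d)          ∎)
    b≍ : b ≍⟨ κ ⟩ s * e
    b≍ = (begin
      b                    ≤⟨ b≤2s ⟩
      2 * s                ≤⟨ *-monoʳ-≤ 2 (m≤m*n s e) ⟩
      2 * (s * e)          ≤⟨ *-monoˡ-≤ (s * e) (x≤κ 2≤2d) ⟩
      κ * (s * e)          ∎) , (begin
      s * e                ≤⟨ *-monoˡ-≤ e s≤b ⟩
      b * e                ≡⟨ *-comm b e ⟩
      e * b                ≤⟨ *-monoˡ-≤ b (x≤κ (≤-trans (n≤1+n e) (m≤m+n d _))) ⟩
      κ * b                ∎)

  balanced-complex : ∀ {s} → d ≤ s → ∀ n → s ≤ n → ComplexWith d n (Balanced κ s e n)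
  balanced-complex {s} d≤s = <-rec (λ n → s ≤ n → ComplexWith d n (Balanced κ s e n)) step
    where
    step : ∀ n → (∀ {m} → m < n → s ≤ m → ComplexWith d m (Balanced κ s e m)) →
           s ≤ n → ComplexWith d n (Balanced κ s e n)
    step n rec s≤n with 2 * s ≤? n
    ... | no  2s≰n = complete-balanced d≤s s≤n (<⇒≤ (≰⇒> 2s≰n))
    ... | yes 2s≤n = subst (λ n → ComplexWith d n (Balanced κ s e n)) (m+[n∸m]≡n s≤n)
      (⊕-balanced (complete-balanced d≤s ≤-refl (m≤m+n s _))
                  (rec (∸-monoʳ-< (≤-trans (s≤s z≤n) d≤s) s≤n) (m+n≤o⇒m≤o∸n s s+s≤n)))
      where
      s+s≤n : s + s ≤ n
      s+s≤n = ≤-trans (≤-reflexive (cong (s +_) (sym (+-identityʳ s)))) 2s≤n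

  -- s is the largest size in [d, n] with n s^e ≤ d^e m; the factor d^e makes s = d admissible.
  scale : ∀ {n m} → d ≤ n → n ≤ m → m ≤ n ^ d → ∃ λ s → d ≤ s × s ≤ n × m ≍⟨ κ ⟩ n * s ^ e
  scale {n} {m} d≤n n≤m m≤n^d
    with s , d≤s , s≤n , ns^e≤d^em , maximal ← maximal-in-range (λ s → n * s ^ e ≤? d ^ e * m)
           (≤-trans (≤-reflexive (*-comm n (d ^ e))) (*-monoʳ-≤ (d ^ e) n≤m)) d≤n
    = s , d≤s , s≤n , m≤κns^e maximal , ≤-trans ns^e≤d^em (*-monoˡ-≤ m (x^k≤κ (m≤m+n d _) (n≤1+n e)))
    where
    open ≤-Reasoning
    1+s≤2s : suc s ≤ 2 * s
    1+s≤2s = ≤-trans (+-monoˡ-≤ s (≤-trans (s≤s z≤n) d≤s)) (≤-reflexive (cong (s +_) (sym (+-identityʳ s))))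
    m≤κns^e : s ≡ n ⊎ ¬ (n * suc s ^ e ≤ d ^ e * m) → m ≤ κ * (n * s ^ e)
    m≤κns^e (inj₁ refl)    = ≤-trans m≤n^d (m≤n*m (n ^ d) κ)
    m≤κns^e (inj₂ ¬P[1+s]) = begin
      m                    ≤⟨ m≤n*m m (d ^ e) {{m^n≢0 d e}} ⟩
      d ^ e * m            ≤⟨ <⇒≤ (≰⇒> ¬P[1+s]) ⟩
      n * suc s ^ e        ≤⟨ *-monoʳ-≤ n (^-monoˡ-≤ e 1+s≤2s) ⟩
      n * (2 * s) ^ e      ≡⟨ cong (n *_) (^-distribʳ-* 2 s e) ⟩
      n * (2 ^ e * s ^ e)  ≡⟨ x∙yz≈y∙xz n (2 ^ e) (s ^ e) ⟩
      2 ^ e * (n * s ^ e)  ≤⟨ *-monoˡ-≤ (n * s ^ e) (x^k≤κ 2≤2d (n≤1+n e)) ⟩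
      κ * (n * s ^ e)      ∎

  A : ℕ
  A = κ * κ

  1≤A : 1 ≤ A
  1≤A = *-mono-≤ (>-nonZero⁻¹ κ) (>-nonZero⁻¹ κ)

  κ^e*κ≤A^e : κ ^ e * κ ≤ A ^ e
  κ^e*κ≤A^e = begin
    κ ^ e * κ      ≤⟨ *-monoʳ-≤ (κ ^ e) (≤-trans (≤-reflexive (sym (*-identityʳ κ))) (^-monoʳ-≤ κ (>-nonZero⁻¹ e))) ⟩
    κ ^ e * κ ^ e  ≡⟨ ^-distribʳ-* κ κ e ⟨
    A ^ e          ∎
    where open ≤-Reasoning

  complex-with-profile : ∀ {n m} → d ≤ n → n ≤ m → m ≤ n ^ d → ComplexWith d n (Profile A e n m)
  complex-with-profile {n} {m} d≤n n≤m m≤n^d with s , d≤s , s≤n , m≍ ← scale d≤n n≤m m≤n^d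
    = ComplexWith-map profile (balanced-complex d≤s n s≤n)
    where
    profile : ∀ N α → Balanced κ s e n N α → Profile A e n m N α
    profile N α (N≍ , n≍) =
      ≍-trans N≍ (≍-sym m≍) , ≍-weaken κ^e*κ≤A^e (≍-trans n^d≍ (≍-*ʳ (α ^ e) (≍-sym m≍)))
      where
      n^d≍ : n ^ d ≍⟨ κ ^ e ⟩ n * s ^ e * α ^ e
      n^d≍ = subst (n ^ d ≍⟨ κ ^ e ⟩_) (trans (cong (n *_) (^-distribʳ-* s α e)) (sym (*-assoc n _ _)))
                   (≍-*ˡ n (≍-^ e n≍))

-- The two regimes

Eventually-map : ∀ {P Q : ℕ → Set} → (∀ n → P n → Q n) → Eventually P → Eventually Q
Eventually-map f (N , p) = N , λ n N≤n → f n (p n N≤n)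

Eventually-× : ∀ {P Q : ℕ → Set} → Eventually P → Eventually Q → Eventually (λ n → P n × Q n)
Eventually-× (M , p) (N , q) =
  M + N , λ n M+N≤n → p n (≤-trans (m≤m+n M N) M+N≤n) , q n (≤-trans (m≤n+m N M) M+N≤n)

eventually-≥ : ∀ k → Eventually (k ≤_)
eventually-≥ k = k , λ _ k≤n → k≤n

m^2≤n^[d+1]⇒m≤n^d : ∀ {m n d} → 1 ≤ n → 1 ≤ d → m ^ 2 ≤ n ^ (d + 1) → m ≤ n ^ d
m^2≤n^[d+1]⇒m≤n^d {m} {n} {d} 1≤n 1≤d m^2≤ = ≮⇒≥ λ n^d<m → <⇒≱ (*-mono-< n^d<m n^d<m) (begin
  m * m          ≡⟨ cong (m *_) (*-identityʳ m) ⟨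
  m ^ 2          ≤⟨ m^2≤ ⟩
  n ^ (d + 1)    ≤⟨ ^-monoʳ-≤ n {{>-nonZero 1≤n}} (+-monoʳ-≤ d 1≤d) ⟩
  n ^ (d + d)    ≡⟨ ^-distribˡ-+-* n d d ⟩
  n ^ d * n ^ d  ∎)
  where open ≤-Reasoning

profile⇒bounds : ∀ {A e n m N α} → Profile A e n m N α →
                 m ≤ A * N × N ≤ A * m × n ^ suc e ≤ m * (A * α) ^ e × m * α ^ e ≤ A ^ e * n ^ suc e
profile⇒bounds {A} {e} {n} {m} {N} {α} ((N≤ , m≤) , (n^d≤ , mα^e≤)) =
  m≤ , N≤ , ≤-trans n^d≤ (≤-reflexive A^e[mα^e]≡m[Aα]^e) , mα^e≤
  where
  A^e[mα^e]≡m[Aα]^e : A ^ e * (m * α ^ e) ≡ m * (A * α) ^ e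
  A^e[mα^e]≡m[Aα]^e = trans (x∙yz≈y∙xz (A ^ e) m (α ^ e)) (cong (m *_) (sym (^-distribʳ-* A α e)))

profile-at-power⇒bounds : ∀ {A e n h h′ N α} .{{_ : NonZero n}} → h + h′ ≡ suc e → Profile A e n (n ^ h) N α →
                          n ^ h ≤ A * N × N ≤ A * n ^ h × n ^ h′ ≤ (A * α) ^ e × α ^ e ≤ A ^ e * n ^ h′
profile-at-power⇒bounds {A} {e} {n} {h} {h′} {N} {α} h+h′≡d ((N≤ , n^h≤) , (n^d≤ , n^hα^e≤)) =
  n^h≤ , N≤ ,
  *-cancelˡ-≤ (n ^ h) {{m^n≢0 n h}} (begin
    n ^ h * n ^ h′           ≡⟨ n^h*n^h′≡n^d ⟩
    n ^ suc e                ≤⟨ n^d≤ ⟩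
    A ^ e * (n ^ h * α ^ e)  ≡⟨ x∙yz≈y∙xz (A ^ e) (n ^ h) (α ^ e) ⟩
    n ^ h * (A ^ e * α ^ e)  ≡⟨ cong (n ^ h *_) (^-distribʳ-* A α e) ⟨
    n ^ h * (A * α) ^ e      ∎) ,
  *-cancelˡ-≤ (n ^ h) {{m^n≢0 n h}} (begin
    n ^ h * α ^ e            ≤⟨ n^hα^e≤ ⟩
    A ^ e * n ^ suc e        ≡⟨ cong (A ^ e *_) n^h*n^h′≡n^d ⟨
    A ^ e * (n ^ h * n ^ h′) ≡⟨ x∙yz≈y∙xz (A ^ e) (n ^ h) (n ^ h′) ⟩
    n ^ h * (A ^ e * n ^ h′) ∎)
  where
  open ≤-Reasoning
  n^h*n^h′≡n^d : n ^ h * n ^ h′ ≡ n ^ suc e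
  n^h*n^h′≡n^d = trans (sym (^-distribˡ-+-* n h h′)) (cong (n ^_) h+h′≡d)

n/2≡⌊n/2⌋ : ∀ n → n / 2 ≡ ⌊ n /2⌋
n/2≡⌊n/2⌋ zero          = refl
n/2≡⌊n/2⌋ (suc zero)    = refl
n/2≡⌊n/2⌋ (suc (suc n)) = trans (m/n≡1+[m∸n]/n {2 + n} {2} (s≤s (s≤s z≤n))) (cong suc (n/2≡⌊n/2⌋ n))

n/2+[n+1]/2≡n : ∀ n → n / 2 + (n + 1) / 2 ≡ n
n/2+[n+1]/2≡n n =
  trans (cong₂ _+_ (n/2≡⌊n/2⌋ n) (trans (n/2≡⌊n/2⌋ (n + 1)) (cong ⌊_/2⌋ (+-comm n 1)))) (⌊n/2⌋+⌈n/2⌉≡n n)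

facet-count-regime : ∀ e .{{_ : NonZero e}} (m : ℕ → ℕ) →
  (∀ k → Eventually (λ n → k * n ≤ m n)) →
  (∀ k → Eventually (λ n → k * (m n ^ 2) ≤ n ^ (suc e + 1))) →
  ∃ λ A → 1 ≤ A × Eventually (λ n → ComplexWith (suc e) n λ N α →
    m n ≤ A * N × N ≤ A * m n × n ^ suc e ≤ m n * (A * α) ^ e × m n * α ^ e ≤ A ^ e * n ^ suc e)
facet-count-regime e m n≪m m≪n^[d+1]/2 =
  A , 1≤A , Eventually-map bounds (Eventually-× (eventually-≥ (suc e)) (Eventually-× (n≪m 1) (m≪n^[d+1]/2 1)))
  where
  open BlockConstruction e using (A; 1≤A; complex-with-profile)
  bounds : ∀ n → suc e ≤ n × 1 * n ≤ m n × 1 * (m n ^ 2) ≤ n ^ (suc e + 1) → ComplexWith (suc e) n λ N α →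
    m n ≤ A * N × N ≤ A * m n × n ^ suc e ≤ m n * (A * α) ^ e × m n * α ^ e ≤ A ^ e * n ^ suc e
  bounds n (d≤n , n≤m , m²≤n^[d+1]) =
    ComplexWith-map (λ N α → profile⇒bounds {A} {e} {n} {m n} {N} {α})
      (complex-with-profile d≤n (subst (_≤ m n) (*-identityˡ n) n≤m)
        (m^2≤n^[d+1]⇒m≤n^d {m n} {n} {suc e} (≤-trans (s≤s z≤n) d≤n) (s≤s z≤n)
          (subst (_≤ n ^ (suc e + 1)) (*-identityˡ (m n ^ 2)) m²≤n^[d+1])))

half-power-regime : ∀ f → let d = 2 + f in
  ∃ λ A → 1 ≤ A × Eventually (λ n → ComplexWith d n λ N α →
    n ^ (d / 2) ≤ A * N × N ≤ A * n ^ (d / 2) ×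
    n ^ ((d + 1) / 2) ≤ (A * α) ^ (d ∸ 1) × α ^ (d ∸ 1) ≤ A ^ (d ∸ 1) * n ^ ((d + 1) / 2))
half-power-regime f = A , 1≤A , Eventually-map bounds (eventually-≥ d)
  where
  open BlockConstruction (suc f) using (A; 1≤A; complex-with-profile)
  d h h′ : ℕ
  d  = 2 + f
  h  = d / 2
  h′ = (d + 1) / 2
  h+h′≡d : h + h′ ≡ d
  h+h′≡d = n/2+[n+1]/2≡n d
  bounds : ∀ n → d ≤ n → ComplexWith d n λ N α →
    n ^ h ≤ A * N × N ≤ A * n ^ h × n ^ h′ ≤ (A * α) ^ suc f × α ^ suc f ≤ A ^ suc f * n ^ h′
  bounds n d≤n =
    ComplexWith-map (λ N α → profile-at-power⇒bounds {A} {suc f} {n} {h} {h′} {N} {α} h+h′≡d)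
      (complex-with-profile d≤n (≤-trans (≤-reflexive (sym (*-identityʳ n))) (^-monoʳ-≤ n 1≤h))
                                (^-monoʳ-≤ n (≤-trans (m≤m+n h h′) (≤-reflexive h+h′≡d))))
    where
    instance
      n≢0 : NonZero n
      n≢0 = >-nonZero (≤-trans (s≤s z≤n) d≤n)
    1≤h : 1 ≤ h
    1≤h = subst (1 ≤_) (sym (n/2≡⌊n/2⌋ d)) (s≤s z≤n)

proposition3p8 : ∀ (d : ℕ) → 2 ≤ d → (m : ℕ → ℕ)
    → (∀ k → Eventually (λ n → k * n ≤ m n))
    → (∀ k → Eventually (λ n → k * (m n ^ 2) ≤ n ^ (d + 1)))
    → (∃ λ A → 1 ≤ A × Eventually (λ n →
          Σ (PureComplex n d) λ K → ∃ λ t → TransversalNumber K t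
            × m n ≤ A * numFacets K × numFacets K ≤ A * m n
            × n ^ d ≤ m n * (A * (n ∸ t)) ^ (d ∸ 1)
            × m n * (n ∸ t) ^ (d ∸ 1) ≤ A ^ (d ∸ 1) * n ^ d))
    × (∃ λ A → 1 ≤ A × Eventually (λ n →
          Σ (PureComplex n d) λ K → ∃ λ t → TransversalNumber K t
            × n ^ (d / 2) ≤ A * numFacets K × numFacets K ≤ A * n ^ (d / 2)
            × n ^ ((d + 1) / 2) ≤ (A * (n ∸ t)) ^ (d ∸ 1)
            × (n ∸ t) ^ (d ∸ 1) ≤ A ^ (d ∸ 1) * n ^ ((d + 1) / 2)))
proposition3p8 (suc zero)    (s≤s ()) _ _ _
proposition3p8 (suc (suc f)) _ m n≪m m≪n^[d+1]/2 =
  facet-count-regime (suc f) m n≪m m≪n^[d+1]/2 , half-power-regime f
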